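{- Let $\mathcal{CA}$ be a correct abstract goal solving system for $\mathrm{SQCLP}(\mathcal{S},\mathcal{D},\mathcal{C})$. Then any flexible restriction $\mathcal{FCA}$ of $\mathcal{CA}$ is correct in the flexible sense.
   Context: Setting: $\mathcal{D}=\langle D,\sqsubseteq,\bot,\top,\circ\rangle$ is a qualification domain, i.e. $\langle D,\sqsubseteq,\bot,\top\rangle$ is a lattice with bottom $\bot$, top $\top$ and meet $\sqcap$, and the attenuation operation $\circ$ is associative, commutative, monotonic, with $d\circ\top=d$, $d\circ\bot=\bot$, $d\circ e\sqsubseteq e$ and $d\circ(e_1\sqcap e_2)=(d\circ e_1)\sqcap(d\circ e_2)$. $\mathcal{C}$ is a constraint domain; $\mathrm{Sol}_{\mathcal{C}}(\Pi)$ is the set of valuations (ground substitutions) satisfying the constraint set $\Pi$. $\mathcal{S}:S\times S\to D$ is a proximity relation (reflexive, symmetric, the identity on variables), extended to terms by $\mathcal{S}(t,t)=\top$, $\mathcal{S}(X,t)=\bot$ for a variable $X\neq t$, $\bot$ for constructors of different arities, and $\mathcal{S}(c(t_1,\dots,t_n),c'(t'_1,\dots,t'_n))=\mathcal{S}(c,c')\sqcap\mathcal{S}(t_1,t'_1)\sqcap\cdots\sqcap\mathcal{S}(t_n,t'_n)$. A program $\mathcal{P}$ of the instance $\mathrm{SQCLP}(\mathcal{S},\mathcal{D},\mathcal{C})$ has clauses $A\xleftarrow{\alpha}B_1\#w_1,\dots,B_m\#w_m$ and a derivability relation $\mathcal{P}\vdash_{\mathrm{SQCHL}(\mathcal{S},\mathcal{D},\mathcal{C})}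 A\#d\Leftarrow\Pi$ on qualified constrained atoms. Goals have the form $G:(A_i\#W_i,\ W_i\sqsupseteq^?\beta_i)_{i=1\ldots m}$ with pairwise distinct qualification variables $W_i$ and $\beta_i\in(D\setminus\{\bot\})\cup\{?\}$, where $e\sqsupseteq^?\beta$ means $e\sqsupseteq\beta$ if $\beta\neq ?$ and is true otherwise. A possible answer is a triple $ans=\langle\sigma,\mu,\Pi\rangle$ with $\sigma$ a $\mathcal{C}$-substitution, $W\mu\in D\setminus\{\bot\}$ for $W$ in the domain of $\mu$, and $\Pi$ a satisfiable finite set of atomic $\mathcal{C}$-constraints; its qualification level is $\lambda_{ans}=W_1\mu\sqcap\cdots\sqcap W_m\mu$. It is a solution iff $W_i\mu\sqsupseteq^?\beta_i$ and $\mathcal{P}\vdash_{\mathrm{SQCHL}(\mathcal{S},\mathcal{D},\mathcal{C})}A_i\sigma\#W_i\mu\Leftarrow\Pi$ for all $i$; $\mathrm{Sol}_{\mathcal{P}}(G)$ is the set of solutions. A solution $\langle\eta,\rho,\emptyset\rangle$ is ground if $\eta$ is a valuation making every $A_i\eta$ ground; $\mathrm{GSol}_{\mathcal{P}}(G)$ is the set of ground solutions. A ground solution $gsol=\langle\eta,\rho,\emptyset\rangle$ is subsumed by $ans=\langle\sigma,\mu,\Pi\rangle$ iff $W_i\mu\sqsupseteq W_i\rho$ for all $i$ and there is $\nu\in\mathrm{Sol}_{\mathcal{C}}(\Pi)$ with $X\eta=X\sigma\nu$ for every variable $X$ of $G$; it is subsumed in the flexible sense iff $\lambda_{ans}\sqsupseteq\lambda_{gsol}$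 and there is $\nu\in\mathrm{Sol}_{\mathcal{C}}(\Pi)$ with $\mathcal{S}(X\eta,X\sigma\nu)\sqsupseteq\lambda_{gsol}$ for every variable $X$ of $G$. An abstract goal solving system $\mathcal{CA}$ maps a program $\mathcal{P}$ and goal $G$ to a set $\mathcal{CA}_{\mathcal{P}}(G)$ of possible answers. It is sound iff $\mathcal{CA}_{\mathcal{P}}(G)\subseteq\mathrm{Sol}_{\mathcal{P}}(G)$; weakly complete (resp. weakly complete in the flexible sense) iff every ground solution is subsumed (resp. subsumed in the flexible sense) by some computed answer; correct iff sound and weakly complete; correct in the flexible sense iff sound and weakly complete in the flexible sense. $\mathcal{FCA}$ is a flexible restriction of $\mathcal{CA}$ iff for all $\mathcal{P}$, $G$: (1) $\mathcal{FCA}_{\mathcal{P}}(G)\subseteq\mathcal{CA}_{\mathcal{P}}(G)$, and (2) for each $ans=\langle\sigma,\mu,\Pi\rangle\in\mathcal{CA}_{\mathcal{P}}(G)$ there is $\widehat{ans}=\langle\hat\sigma,\hat\mu,\Pi\rangle\in\mathcal{FCA}_{\mathcal{P}}(G)$ with $\lambda_{\widehat{ans}}\sqsupseteq\lambda_{ans}$ and $\mathcal{S}(X\sigma,X\hat\sigma)\sqsupseteq\lambda_{ans}$ for every variable $X$ of $G$. -}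

module Defs where

open import Data.Nat using (ℕ; zero; suc)
import Data.Nat as ℕ
open import Data.Fin using (Fin; zero; suc)
open import Data.List using (List; []; _∷_; length; map)
open import Data.List.Relation.Unary.Any using (Any)
open import Data.List.Relation.Unary.All using (All)
open import Data.Maybe using (Maybe; just; nothing)
open import Data.Product using (Σ; ∃; ∃-syntax; _×_; _,_)
open import Data.Unit using () renaming (⊤ to Unit)
open import Relation.Nullary using (¬_; yes; no)
open import Relation.Binary.PropositionalEquality using (_≡_; _≢_)
open import Relation.Binary.Structures using (IsPartialOrder)
open import Relation.Binary.Definitions using (Minimum; Maximum)
open import Relation.Binary.Lattice.Definitions using (Infimum; Supremum)

record QualificationDomain : Set₁ where
  infix  4 _⊑_
  infixr 7 _⊓_
  infixr 6 _⊔_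
  infixr 8 _∘_
  field
    D             : Set
    _⊑_           : D → D → Set
    isPartialOrder : IsPartialOrder _≡_ _⊑_
    _⊓_ _⊔_       : D → D → D
    ⊓-infimum     : Infimum _⊑_ _⊓_
    ⊔-supremum    : Supremum _⊑_ _⊔_
    ⊥ ⊤           : D
    ⊥-least       : Minimum _⊑_ ⊥
    ⊤-greatest    : Maximum _⊑_ ⊤
    _∘_           : D → D → D
    ∘-assoc       : ∀ a b c → (a ∘ b) ∘ c ≡ a ∘ (b ∘ c)
    ∘-comm        : ∀ a b → a ∘ b ≡ b ∘ a
    ∘-mono        : ∀ {a a′ b b′} → a ⊑ a′ → b ⊑ b′ → a ∘ b ⊑ a′ ∘ b′
    ∘-identityʳ   : ∀ d → d ∘ ⊤ ≡ d
    ∘-zeroʳ       : ∀ d → d ∘ ⊥ ≡ ⊥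
    ∘-attenuates  : ∀ d e → d ∘ e ⊑ e
    ∘-distrib-⊓   : ∀ d e₁ e₂ → d ∘ (e₁ ⊓ e₂) ≡ (d ∘ e₁) ⊓ (d ∘ e₂)

data Term (Sym : Set) : Set where
  var : ℕ → Term Sym
  con : Sym → List (Term Sym) → Term Sym

Subst : Set → Set
Subst Sym = ℕ → Term Sym

module _ {Sym : Set} where

  mutual
    _⟪_⟫ : Term Sym → Subst Sym → Term Sym
    var X    ⟪ σ ⟫ = σ X
    con c ts ⟪ σ ⟫ = con c (ts ⟪ σ ⟫s)

    _⟪_⟫s : List (Term Sym) → Subst Sym → List (Term Sym)
    []       ⟪ σ ⟫s = []
    (t ∷ ts) ⟪ σ ⟫s = t ⟪ σ ⟫ ∷ ts ⟪ σ ⟫s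

  data Occurs (X : ℕ) : Term Sym → Set where
    here  : Occurs X (var X)
    inArg : ∀ {c ts} → Any (Occurs X) ts → Occurs X (con c ts)

  Ground : Term Sym → Set
  Ground t = ∀ X → ¬ Occurs X t

  IsValuation : Subst Sym → Set
  IsValuation η = ∀ X → Ground (η X)

record Atom (Sym Pred : Set) : Set where
  constructor _⦅_⦆
  field
    pred : Pred
    args : List (Term Sym)

record Instance : Set₁ where
  field
    QD        : QualificationDomain
  open QualificationDomain QD public
  field
    Sym       : Set
    Pred      : Set
    S         : Sym → Sym → D
    S-refl    : ∀ c → S c c ≡ ⊤
    S-sym     : ∀ c c′ → S c c′ ≡ S c′ c
    Constraint : Set
    _⊨_        : Subst Sym → Constraint → Set
    -- programs and the SQCHL(S,D,C) derivability  P ⊢ A#d ⇐ Π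
    Program   : Set
    Derives   : Program → Atom Sym Pred → D → List Constraint → Set

module Framework (I : Instance) where
  open Instance I

  Tm = Term Sym

  SolC : List Constraint → Subst Sym → Set
  SolC Π ν = IsValuation ν × All (ν ⊨_) Π

  Satisfiable : List Constraint → Set
  Satisfiable Π = ∃[ ν ] SolC Π ν

  mutual
    simT : Tm → Tm → D
    simT (var X) (var Y) with X ℕ.≟ Y
    ... | yes _ = ⊤
    ... | no  _ = ⊥
    simT (var _) (con _ _) = ⊥
    simT (con _ _) (var _) = ⊥
    simT (con c ts) (con c′ ts′) with length ts ℕ.≟ length ts′
    ... | yes _ = S c c′ ⊓ simL ts ts′
    ... | no  _ = ⊥

    simL : List Tm → List Tm → D
    simL []       []         = ⊤
    simL (t ∷ ts) (t′ ∷ ts′) = simT t t′ ⊓ simL ts ts′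
    simL _        _          = ⊥

  applyA : Atom Sym Pred → Subst Sym → Atom Sym Pred
  applyA (p ⦅ ts ⦆) σ = p ⦅ ts ⟪ σ ⟫s ⦆

  -- e ⊒? β   (β = nothing encodes '?')
  _⊒?_ : D → Maybe D → Set
  e ⊒? nothing = Unit
  e ⊒? just β  = β ⊑ e

  ⨅ : ∀ n → (Fin n → D) → D
  ⨅ zero    f = ⊤
  ⨅ (suc n) f = f zero ⊓ ⨅ n (λ i → f (suc i))

  -- goals (A_i # W_i , W_i ⊒? β_i)_{i=1..m}; W_i is represented by the index i
  record Goal : Set where
    field
      m       : ℕ
      atom    : Fin m → Atom Sym Pred
      bound   : Fin m → Maybe D
      boundOk : ∀ i β → bound i ≡ just β → β ≢ ⊥

  open Goal public

  VarOf : Goal → ℕ → Set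
  VarOf G X = ∃[ i ] Any (Occurs X) (Atom.args (atom G i))

  -- ⟨σ, μ, Π⟩ ; μ i stands for W_i μ
  record Answer (G : Goal) : Set where
    constructor ⟨_,_,_⟩
    field
      σ : Subst Sym
      μ : Fin (m G) → D
      Π : List Constraint

  open Answer public

  PossibleAnswer : (G : Goal) → Answer G → Set
  PossibleAnswer G a = (∀ i → μ a i ≢ ⊥) × Satisfiable (Π a)

  level : {G : Goal} → Answer G → D
  level {G} a = ⨅ (m G) (μ a)

  IsSolution : Program → (G : Goal) → Answer G → Set
  IsSolution P G a =
    PossibleAnswer G a ×
    (∀ i → (μ a i ⊒? bound G i) × Derives P (applyA (atom G i) (σ a)) (μ a i) (Π a))

  IsGroundSolution : Program → (G : Goal) → Answer G → Set
  IsGroundSolution P G a = IsSolution P G a × IsValuation (σ a) × Π a ≡ []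

  Subsumed : (G : Goal) → (gsol ans : Answer G) → Set
  Subsumed G gsol ans =
    (∀ i → μ gsol i ⊑ μ ans i) ×
    ∃[ ν ] (SolC (Π ans) ν × (∀ X → VarOf G X → σ gsol X ≡ (σ ans X) ⟪ ν ⟫))

  SubsumedFlex : (G : Goal) → (gsol ans : Answer G) → Set
  SubsumedFlex G gsol ans =
    level gsol ⊑ level ans ×
    ∃[ ν ] (SolC (Π ans) ν ×
            (∀ X → VarOf G X → level gsol ⊑ simT (σ gsol X) ((σ ans X) ⟪ ν ⟫)))

  record GoalSolvingSystem : Set₁ where
    field
      answers  : Program → (G : Goal) → Answer G → Set
      possible : ∀ {P G a} → answers P G a → PossibleAnswer G a

  open GoalSolvingSystem public

  Sound : GoalSolvingSystem → Set
  Sound CA = ∀ P G a → answers CA P G a → IsSolution P G a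

  WeaklyComplete : GoalSolvingSystem → Set
  WeaklyComplete CA = ∀ P G gsol → IsGroundSolution P G gsol →
    ∃[ ans ] (answers CA P G ans × Subsumed G gsol ans)

  WeaklyCompleteFlex : GoalSolvingSystem → Set
  WeaklyCompleteFlex CA = ∀ P G gsol → IsGroundSolution P G gsol →
    ∃[ ans ] (answers CA P G ans × SubsumedFlex G gsol ans)

  Correct : GoalSolvingSystem → Set
  Correct CA = Sound CA × WeaklyComplete CA

  CorrectFlex : GoalSolvingSystem → Set
  CorrectFlex CA = Sound CA × WeaklyCompleteFlex CA

  FlexibleRestriction : (FCA CA : GoalSolvingSystem) → Set
  FlexibleRestriction FCA CA = ∀ P G →
    (∀ a → answers FCA P G a → answers CA P G a) ×
    (∀ ans → answers CA P G ans →
       ∃[ ans′ ] (answers FCA P G ans′ × Π ans′ ≡ Π ans ×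
                  level ans ⊑ level ans′ ×
                  (∀ X → VarOf G X → level ans ⊑ simT (σ ans X) (σ ans′ X))))

-- The ground solution is subsumed by a CA-answer ans with the same witness ν; the
-- flexible restriction supplies an FCA-answer ans′ with the same constraints whose
-- qualification level and bindings are λ_ans-close to those of ans.  Since
-- λ_gsol ⊑ λ_ans and proximity can only grow under the substitution ν, ans′
-- subsumes gsol in the flexible sense.
module Submission where

open import Defs
open import Data.Nat using (suc)
import Data.Nat as ℕ
open import Data.Fin using (Fin; zero; suc)
open import Data.List using (List; []; _∷_; length)
open import Data.List.Relation.Unary.All using (All)
open import Data.Product using (_×_; _,_; proj₁; proj₂)
open import Data.Empty using (⊥-elim)
open import Relation.Nullary using (yes; no)
open import Relation.Binary.PropositionalEquality
  using (_≡_; refl; cong; subst; sym; trans)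
open import Relation.Binary.Lattice.Bundles using (MeetSemilattice)
import Relation.Binary.Lattice.Properties.MeetSemilattice as MeetSemilatticeProperties

module QualificationLattice (QD : QualificationDomain) where
  open QualificationDomain QD

  meetSemilattice : MeetSemilattice _ _ _
  meetSemilattice = record
    { isMeetSemilattice = record { isPartialOrder = isPartialOrder ; infimum = ⊓-infimum } }

  open MeetSemilattice meetSemilattice public
    using (poset; reflexive; ∧-greatest)
    renaming (refl to ⊑-refl; trans to ⊑-trans)
  open MeetSemilatticeProperties meetSemilattice public
    using () renaming (∧-monotonic to ⊓-mono)

module Proximity (I : Instance) where
  open Instance I
  open Framework I
  open QualificationLattice QD

  length-⟪⟫s : ∀ (ts : List Tm) ν → length (ts ⟪ ν ⟫s) ≡ length ts
  length-⟪⟫s []       ν = refl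
  length-⟪⟫s (t ∷ ts) ν = cong suc (length-⟪⟫s ts ν)

  mutual
    simT-refl : ∀ t → ⊤ ⊑ simT t t
    simT-refl (var X) with X ℕ.≟ X
    ... | yes _  = ⊑-refl
    ... | no X≢X = ⊥-elim (X≢X refl)
    simT-refl (con c ts) with length ts ℕ.≟ length ts
    ... | yes _  = ∧-greatest (reflexive (sym (S-refl c))) (simL-refl ts)
    ... | no n≢n = ⊥-elim (n≢n refl)

    simL-refl : ∀ ts → ⊤ ⊑ simL ts ts
    simL-refl []       = ⊑-refl
    simL-refl (t ∷ ts) = ∧-greatest (simT-refl t) (simL-refl ts)

  mutual
    simT-⟪⟫ : ∀ t s ν → simT t s ⊑ simT (t ⟪ ν ⟫) (s ⟪ ν ⟫)
    simT-⟪⟫ (var X) (var Y) ν with X ℕ.≟ Y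
    ... | yes refl = simT-refl (ν X)
    ... | no _     = ⊥-least _
    simT-⟪⟫ (var _)   (con _ _) ν = ⊥-least _
    simT-⟪⟫ (con _ _) (var _)   ν = ⊥-least _
    simT-⟪⟫ (con c ts) (con c′ ts′) ν with length ts ℕ.≟ length ts′
    ... | no _ = ⊥-least _
    ... | yes n≡n′ with length (ts ⟪ ν ⟫s) ℕ.≟ length (ts′ ⟪ ν ⟫s)
    ...   | yes _ = ⊓-mono ⊑-refl (simL-⟪⟫ ts ts′ ν)
    ...   | no n≢n′ =
            ⊥-elim (n≢n′ (trans (length-⟪⟫s ts ν) (trans n≡n′ (sym (length-⟪⟫s ts′ ν)))))

    simL-⟪⟫ : ∀ ts ss ν → simL ts ss ⊑ simL (ts ⟪ ν ⟫s) (ss ⟪ ν ⟫s)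
    simL-⟪⟫ []       []       ν = ⊑-refl
    simL-⟪⟫ []       (_ ∷ _)  ν = ⊥-least _
    simL-⟪⟫ (_ ∷ _)  []       ν = ⊥-least _
    simL-⟪⟫ (t ∷ ts) (s ∷ ss) ν = ⊓-mono (simT-⟪⟫ t s ν) (simL-⟪⟫ ts ss ν)

module Subsumption (I : Instance) where
  open Instance I
  open Framework I
  open QualificationLattice QD
  open Proximity I
  open import Relation.Binary.Reasoning.PartialOrder poset

  ⨅-mono : ∀ n {f g : Fin n → D} → (∀ i → f i ⊑ g i) → ⨅ n f ⊑ ⨅ n g
  ⨅-mono ℕ.zero    f⊑g = ⊑-refl
  ⨅-mono (suc n) f⊑g = ⊓-mono (f⊑g zero) (⨅-mono n (λ i → f⊑g (suc i)))

  Approximates : (G : Goal) → (ans ans′ : Answer G) → Set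
  Approximates G ans ans′ =
    Π ans′ ≡ Π ans × level ans ⊑ level ans′ ×
    (∀ X → VarOf G X → level ans ⊑ simT (σ ans X) (σ ans′ X))

  subsumed⇒level⊑ : ∀ {G} gsol ans → Subsumed G gsol ans → level gsol ⊑ level ans
  subsumed⇒level⊑ {G} _ _ (μ⊑ , _) = ⨅-mono (m G) μ⊑

  subsumed-approximates⇒subsumedFlex : ∀ {G} gsol ans ans′ →
    Subsumed G gsol ans → Approximates G ans ans′ → SubsumedFlex G gsol ans′
  subsumed-approximates⇒subsumedFlex {G} gsol ans ans′
    sub@(_ , ν , (ν-valuation , ν⊨Π) , σgsol≡) (Π′≡Π , level⊑ , close) =
      ⊑-trans gsol⊑ans level⊑ ,
      ν , (ν-valuation , subst (All (ν ⊨_)) (sym Π′≡Π) ν⊨Π) , flex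
    where
    gsol⊑ans : level gsol ⊑ level ans
    gsol⊑ans = subsumed⇒level⊑ gsol ans sub

    flex : ∀ X → VarOf G X → level gsol ⊑ simT (σ gsol X) (σ ans′ X ⟪ ν ⟫)
    flex X x∈G = begin
      level gsol                                   ≤⟨ gsol⊑ans ⟩
      level ans                                    ≤⟨ close X x∈G ⟩
      simT (σ ans X) (σ ans′ X)                    ≤⟨ simT-⟪⟫ (σ ans X) (σ ans′ X) ν ⟩
      simT (σ ans X ⟪ ν ⟫) (σ ans′ X ⟪ ν ⟫)        ≡⟨ cong (λ t → simT t (σ ans′ X ⟪ ν ⟫)) (σgsol≡ X x∈G) ⟨
      simT (σ gsol X) (σ ans′ X ⟪ ν ⟫)             ∎

lemma2p1 : (I : Instance) (CA FCA : Framework.GoalSolvingSystem I) →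
    Framework.Correct I CA →
    Framework.FlexibleRestriction I FCA CA →
    Framework.CorrectFlex I FCA
lemma2p1 I CA FCA (sound , weaklyComplete) restriction = soundFCA , weaklyCompleteFlexFCA
  where
  open Framework I
  open Subsumption I

  soundFCA : Sound FCA
  soundFCA P G a a∈FCA = sound P G a (proj₁ (restriction P G) a a∈FCA)

  weaklyCompleteFlexFCA : WeaklyCompleteFlex FCA
  weaklyCompleteFlexFCA P G gsol isGround
    with weaklyComplete P G gsol isGround
  ... | ans , ans∈CA , subsumed
    with proj₂ (restriction P G) ans ans∈CA
  ... | ans′ , ans′∈FCA , approximates =
    ans′ , ans′∈FCA , subsumed-approximates⇒subsumedFlex gsol ans ans′ subsumed approximates
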